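{- Let $q$ be a prime power, $\delta_i\in\mathbb{F}_{q^2}$ with $\delta_i^{q+1}=1$, $s(x)=x^q+\delta_ix$, $m\ge2$ an integer, $a_i\in\mathbb{F}_q$ for $2\le i\le m$ with $a_m=1$, and $\lambda$ a nonzero element of the image of $s$. Put $g(y)=\sum_{i=2}^m\lambda^{m-i}a_iy^i$. Let $L(x)$ be a linearized polynomial over $\mathbb{F}_{q^2}$ of rank $2$ such that $L(\ker s)$ is contained in the $\mathbb{F}_q$-span of $\lambda^m$, and suppose $f(x)=g(s(x))+L(x)$ is a (normalized) permutation polynomial of $\mathbb{F}_{q^2}$. Let $M(x)$ be the (rank $2$ linearized) compositional inverse of $L(x)$, and let $\delta_j\in\mathbb{F}_{q^2}$ with $\delta_j^{q+1}=1$ be such that $\lambda^m\in\ker(x^q+\delta_jx)$. Then there is a polynomial $g_1\in\mathbb{F}_{q^2}[y]$ such that $h(x)=g_1(x^q+\delta_jx)+M(x)$ is the compositional inverse of $f$.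
   Context: A linearized polynomial over $\mathbb{F}_{q^2}$ is $L(x)=\alpha_1x^q+\alpha_0x$ with $\alpha_0,\alpha_1\in\mathbb{F}_{q^2}$; its rank, kernel and image are those of the $\mathbb{F}_q$-linear evaluation map on $\mathbb{F}_{q^2}$. A permutation polynomial of $\mathbb{F}_{q^2}$ is one whose evaluation map is a bijection; "normalized" means monic and mapping $0$ to $0$. $h$ is the compositional inverse of $f$ if $f(h(x))=h(f(x))=x$ for all $x\in\mathbb{F}_{q^2}$. -}

module Defs where

open import Level using (0ℓ)
open import Data.Nat using (ℕ; zero; suc; _≤_; _^_) renaming (_+_ to _+ℕ_)
open import Data.Nat.Primality using (Prime)
open import Data.Fin using (Fin)
open import Data.List using (List; []; _∷_)
open import Data.Product using (Σ; ∃; _×_; _,_)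
open import Relation.Binary.PropositionalEquality using (_≡_)
open import Relation.Nullary using (¬_)
open import Algebra.Structures using (IsCommutativeRing)
open import Function.Bundles using (_↔_)

IsPrimePower : ℕ → Set
IsPrimePower q = Σ ℕ λ p → Σ ℕ λ k → Prime p × (1 ≤ k) × (q ≡ p ^ k)

record FiniteField (n : ℕ) : Set₁ where
  infixl 6 _+_
  infixl 7 _*_
  field
    K    : Set
    _+_  : K → K → K
    _*_  : K → K → K
    -_   : K → K
    0#   : K
    1#   : K
    isCommutativeRing : IsCommutativeRing _≡_ _+_ _*_ -_ 0# 1#
    0≢1  : ¬ (0# ≡ 1#)
    inv  : ∀ (x : K) → ¬ (x ≡ 0#) → Σ K λ y → x * y ≡ 1#
    card : Fin n ↔ K

  _^ᶠ_ : K → ℕ → K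
  x ^ᶠ zero = 1#
  x ^ᶠ suc k = x * (x ^ᶠ k)

  -- Horner evaluation of a polynomial given by its coefficient list
  -- [c₀, c₁, …, cₙ] (c₀ is the constant term)
  evalPoly : List K → K → K
  evalPoly [] y = 0#
  evalPoly (c ∷ cs) y = c + y * evalPoly cs y

  -- Σ_{i=lo}^{lo+len-1} t i
  sumFrom : ℕ → ℕ → (ℕ → K) → K
  sumFrom lo zero t = 0#
  sumFrom lo (suc len) t = t lo + sumFrom (suc lo) len t

module OverFq² (q : ℕ) (F : FiniteField (q ^ 2)) where
  open FiniteField F public

  InFq : K → Set
  InFq a = a ^ᶠ q ≡ a

  -- linearized polynomial α₁ x^q + α₀ x over F_{q²}, given as (α₁ , α₀)
  LinPoly : Set
  LinPoly = K × K

  evalLin : LinPoly → K → K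
  evalLin (α₁ , α₀) x = α₁ * (x ^ᶠ q) + α₀ * x

  -- rank 2: the image of the F_q-linear evaluation map is all of F_{q²}
  -- (which is 2-dimensional over F_q)
  Rank2 : LinPoly → Set
  Rank2 L = ∀ y → ∃ λ x → evalLin L x ≡ y

  IsPermutation : (K → K) → Set
  IsPermutation f = (∀ x y → f x ≡ f y → x ≡ y) × (∀ y → ∃ λ x → f x ≡ y)

  IsCompInverse : (K → K) → (K → K) → Set
  IsCompInverse f h = (∀ x → f (h x) ≡ x) × (∀ x → h (f x) ≡ x)

-- Write s_δ(x) = x^q + δx. The kernel of s_δj is the F_q-line through λ^m, and L maps the
-- (nonzero) F_q-line ker s_δi into it, hence onto it. As f(x + z) = f(x) + L(z) for z ∈ ker s_δi,
-- the inverse h of f satisfies h(x + e) = h(x) + M(e) for e ∈ ker s_δj, so h − M is constant on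
-- the fibres of s_δj: h − M = v ∘ s_δj, and every map v of a finite field is a polynomial.
-- The finite-field facts behind this are derived from the axioms: q²·1 = 0 (sum x + 1 over the
-- field), x^(q²) = x (compare ∏ ψ(ax) with ∏ ψ(x), where ψ replaces 0 by 1), additivity of x ↦ x^q
-- (binomial theorem), and ker s_δ ≠ 0 because x^q − cx has at most q roots.

module Submission where

open import Defs
open import Data.Nat using (ℕ; _≤_; _^_; _∸_)
open import Data.List using (List)
open import Data.Product using (Σ; ∃; _×_; _,_)
open import Relation.Binary.PropositionalEquality using (_≡_)
open import Relation.Nullary using (¬_)

open import Level using (0ℓ)
open import Data.Nat as ℕ using (zero; suc; _!; NonTrivial)
import Data.Nat.Properties as ℕ
open import Data.Nat.Combinatorics using (_C_; k![n∸k]!∣n!; nCn≡1)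
open import Data.Nat.Combinatorics.Specification using (nCk≡n!/k![n-k]!)
open import Data.Nat.DivMod using (m/n*n≡m)
open import Data.Nat.Divisibility using (_∣_; divides; ∣⇒≤; ∣1⇒≡1; m∣m*n)
open import Data.Nat.Primality using (Prime; euclidsLemma; prime⇒nonTrivial)
open import Data.Integer as ℤ using (ℤ; -[1+_])
import Data.Integer.Properties as ℤ
import Data.Sign as Sign
open import Data.Fin as Fin using (Fin)
import Data.Fin.Properties as Fin
open import Data.Fin.Permutation as Perm using (Permutation)
open import Data.Vec.Functional using (removeAt)
open import Data.List as List using ([]; _∷_; length)
open import Data.List.Relation.Unary.All using (All; []; _∷_)
open import Data.Maybe using (Maybe; just; nothing)
import Data.Product
open import Data.Product using (proj₁; proj₂)
open import Data.Sum using (_⊎_; inj₁; inj₂; [_,_]′)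
open import Data.Empty using (⊥-elim)
open import Function.Base using (_∘_; id)
open import Function.Bundles using (Inverse)
open import Function.Definitions using (Injective)
open import Relation.Nullary using (Dec; yes; no)
open import Relation.Nullary.Decidable using (map′)
open import Relation.Binary.Definitions using (DecidableEquality)
open import Relation.Binary.PropositionalEquality using (_≢_; refl; sym; trans; cong; cong₂; subst; subst₂; module ≡-Reasoning)
open import Algebra.Bundles using (CommutativeRing)
open import Algebra.Structures using (IsCommutativeRing)
import Algebra.Properties.CommutativeMonoid.Sum as CommutativeMonoidSum
import Algebra.Properties.CommutativeSemigroup as CommutativeSemigroupProperties
import Algebra.Properties.Ring as RingProperties
import Algebra.Properties.Semiring.Binomial as BinomialTheorem
import Algebra.Properties.Semiring.Exp as SemiringExp
import Algebra.Properties.Semiring.Mult as SemiringMult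
import Algebra.Properties.Semiring.Mult.TCOptimised as SemiringMultTCOptimised
import Algebra.Solver.Ring.AlmostCommutativeRing as AlmostCommutativeRing

-- Coefficients must be integers, not ring elements: normalising x - x to 0 has to decide that a
-- coefficient vanishes, which is impossible for abstract elements of the ring.
module IntegerCoefficientSolver
  {A : Set} {add mul : A → A → A} {neg : A → A} {null unit : A}
  (isCR : IsCommutativeRing _≡_ add mul neg null unit) where

  ring : CommutativeRing 0ℓ 0ℓ
  ring = record { isCommutativeRing = isCR }

  open CommutativeRing ring
    using (_+_; _*_; -_; 0#; 1#; +-assoc; +-comm; +-identityˡ; +-identityʳ; *-identityˡ; -‿inverseʳ; zeroʳ; semiring)
  open RingProperties (CommutativeRing.ring ring) using (-‿involutive; -0#≈0#; -‿distribˡ-*; -‿+-comm)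
  open CommutativeSemigroupProperties (CommutativeRing.*-commutativeSemigroup ring) using (interchange)
  open SemiringMultTCOptimised semiring using (×-homo-+; ×1-homo-*) renaming (_×_ to _×ᵐ_)
  open ≡-Reasoning

  ι : ℕ → A
  ι n = n ×ᵐ 1#

  ι-+ : ∀ a b → ι (a ℕ.+ b) ≡ ι a + ι b
  ι-+ = ×-homo-+ 1#

  ι-* : ∀ a b → ι (a ℕ.* b) ≡ ι a * ι b
  ι-* = ×1-homo-*

  private
    ⟦_⟧ : ℤ → A
    ⟦ ℤ.+ n ⟧ = ι n
    ⟦ -[1+ n ] ⟧ = - ι (suc n)

    cancel-1 : ∀ a b → (1# + a) + - (1# + b) ≡ a + - b
    cancel-1 a b = begin
      (1# + a) + - (1# + b)    ≡⟨ cong ((1# + a) +_) (sym (-‿+-comm 1# b)) ⟩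
      (1# + a) + (- 1# + - b)  ≡⟨ cong (_+ (- 1# + - b)) (+-comm 1# a) ⟩
      (a + 1#) + (- 1# + - b)  ≡⟨ +-assoc a 1# _ ⟩
      a + (1# + (- 1# + - b))  ≡⟨ cong (a +_) (sym (+-assoc 1# (- 1#) (- b))) ⟩
      a + ((1# + - 1#) + - b)  ≡⟨ cong (λ z → a + (z + - b)) (-‿inverseʳ 1#) ⟩
      a + (0# + - b)           ≡⟨ cong (a +_) (+-identityˡ (- b)) ⟩
      a + - b                  ∎

    ⟦⊖⟧ : ∀ m n → ⟦ m ℤ.⊖ n ⟧ ≡ ι m + - ι n
    ⟦⊖⟧ zero zero = sym (-‿inverseʳ 0#)
    ⟦⊖⟧ zero (suc n) = sym (+-identityˡ _)
    ⟦⊖⟧ (suc m) zero = sym (trans (cong (ι (suc m) +_) -0#≈0#) (+-identityʳ _))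
    ⟦⊖⟧ (suc m) (suc n) = begin
      ⟦ suc m ℤ.⊖ suc n ⟧         ≡⟨ cong ⟦_⟧ (ℤ.[1+m]⊖[1+n]≡m⊖n m n) ⟩
      ⟦ m ℤ.⊖ n ⟧                 ≡⟨ ⟦⊖⟧ m n ⟩
      ι m + - ι n                 ≡⟨ sym (cancel-1 (ι m) (ι n)) ⟩
      (1# + ι m) + - (1# + ι n)   ≡⟨ sym (cong₂ (λ a b → a + - b) (ι-+ 1 m) (ι-+ 1 n)) ⟩
      ι (suc m) + - ι (suc n)     ∎

    sign : Sign.Sign → A
    sign Sign.+ = 1#
    sign Sign.- = - 1#

    sign-* : ∀ s t → sign (s Sign.* t) ≡ sign s * sign t
    sign-* Sign.- Sign.- = sym (trans (sym (-‿distribˡ-* 1# (- 1#))) (trans (cong -_ (*-identityˡ _)) (-‿involutive 1#)))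
    sign-* Sign.- Sign.+ = sym (CommutativeRing.*-identityʳ ring _)
    sign-* Sign.+ t = sym (*-identityˡ _)

    ⟦◃⟧ : ∀ s n → ⟦ s ℤ.◃ n ⟧ ≡ sign s * ι n
    ⟦◃⟧ s zero = sym (zeroʳ _)
    ⟦◃⟧ Sign.- (suc n) = trans (cong -_ (sym (*-identityˡ _))) (-‿distribˡ-* 1# _)
    ⟦◃⟧ Sign.+ (suc n) = sym (*-identityˡ _)

    ⟦⟧-sign-abs : ∀ i → ⟦ i ⟧ ≡ sign (ℤ.sign i) * ι ℤ.∣ i ∣
    ⟦⟧-sign-abs i = trans (cong ⟦_⟧ (sym (ℤ.◃-inverse i))) (⟦◃⟧ (ℤ.sign i) ℤ.∣ i ∣)

    ⟦⟧-+ : ∀ i j → ⟦ i ℤ.+ j ⟧ ≡ ⟦ i ⟧ + ⟦ j ⟧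
    ⟦⟧-+ -[1+ m ] -[1+ n ] = begin
      - ι (suc (suc (m ℕ.+ n)))     ≡⟨ cong (λ k → - ι (suc k)) (sym (ℕ.+-suc m n)) ⟩
      - ι (suc m ℕ.+ suc n)         ≡⟨ cong -_ (ι-+ (suc m) (suc n)) ⟩
      - (ι (suc m) + ι (suc n))     ≡⟨ sym (-‿+-comm _ _) ⟩
      - ι (suc m) + - ι (suc n)     ∎
    ⟦⟧-+ -[1+ m ] (ℤ.+ n) = trans (⟦⊖⟧ n (suc m)) (+-comm _ _)
    ⟦⟧-+ (ℤ.+ m) -[1+ n ] = ⟦⊖⟧ m (suc n)
    ⟦⟧-+ (ℤ.+ m) (ℤ.+ n) = ι-+ m n

    ⟦⟧-* : ∀ i j → ⟦ i ℤ.* j ⟧ ≡ ⟦ i ⟧ * ⟦ j ⟧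
    ⟦⟧-* i j = begin
      ⟦ i ℤ.* j ⟧                                                    ≡⟨ ⟦◃⟧ (ℤ.sign i Sign.* ℤ.sign j) (ℤ.∣ i ∣ ℕ.* ℤ.∣ j ∣) ⟩
      sign (ℤ.sign i Sign.* ℤ.sign j) * ι (ℤ.∣ i ∣ ℕ.* ℤ.∣ j ∣)      ≡⟨ cong₂ _*_ (sign-* (ℤ.sign i) (ℤ.sign j)) (ι-* ℤ.∣ i ∣ ℤ.∣ j ∣) ⟩
      (sign (ℤ.sign i) * sign (ℤ.sign j)) * (ι ℤ.∣ i ∣ * ι ℤ.∣ j ∣)  ≡⟨ interchange _ _ _ _ ⟩
      (sign (ℤ.sign i) * ι ℤ.∣ i ∣) * (sign (ℤ.sign j) * ι ℤ.∣ j ∣)  ≡⟨ sym (cong₂ _*_ (⟦⟧-sign-abs i) (⟦⟧-sign-abs j)) ⟩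
      ⟦ i ⟧ * ⟦ j ⟧                                                  ∎

    ⟦⟧-neg : ∀ i → ⟦ ℤ.- i ⟧ ≡ - ⟦ i ⟧
    ⟦⟧-neg -[1+ n ] = sym (-‿involutive _)
    ⟦⟧-neg (ℤ.+ zero) = sym -0#≈0#
    ⟦⟧-neg (ℤ.+ suc n) = refl

    integerHomomorphism : AlmostCommutativeRing._-Raw-AlmostCommutative⟶_ ℤ.+-*-rawRing (AlmostCommutativeRing.fromCommutativeRing ring)
    integerHomomorphism = record
      { ⟦_⟧ = ⟦_⟧ ; +-homo = ⟦⟧-+ ; *-homo = ⟦⟧-* ; -‿homo = ⟦⟧-neg ; 0-homo = refl ; 1-homo = refl }

    _≟⟦⟧_ : ∀ i j → Maybe (⟦ i ⟧ ≡ ⟦ j ⟧)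
    i ≟⟦⟧ j with i ℤ.≟ j
    ... | yes i≡j = just (cong ⟦_⟧ i≡j)
    ... | no _ = nothing

  open import Algebra.Solver.Ring ℤ.+-*-rawRing (AlmostCommutativeRing.fromCommutativeRing ring) integerHomomorphism _≟⟦⟧_ public
    using (solve; _:=_; _:+_; _:*_; _:-_; :-_; con)


prime⇒2≤ : ∀ {p} → Prime p → 2 ℕ.≤ p
prime⇒2≤ {p} p-prime = ℕ.nonTrivial⇒n>1 p {{prime⇒nonTrivial p-prime}}

prime∤! : ∀ {p} → Prime p → ∀ j → j ℕ.< p → ¬ (p ∣ j !)
prime∤! p-prime zero j<p p∣1 with ∣1⇒≡1 p∣1 | prime⇒2≤ p-prime
... | refl | ℕ.s≤s ()
prime∤! p-prime (suc j) 1+j<p p∣[1+j]! with euclidsLemma (suc j) (j !) p-prime p∣[1+j]!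
... | inj₁ p∣1+j = ℕ.<⇒≱ 1+j<p (∣⇒≤ p∣1+j)
... | inj₂ p∣j! = prime∤! p-prime j (ℕ.<-trans (ℕ.n<1+n j) 1+j<p) p∣j!

prime∣C : ∀ {p k} → Prime p → 0 ℕ.< k → k ℕ.< p → p ∣ p C k
prime∣C {p} {k} p-prime 0<k k<p with euclidsLemma (p C k) (k ! ℕ.* (p ∸ k) !) p-prime p∣C*k!*[p∸k]!
  where
  k≤p = ℕ.<⇒≤ k<p
  C*k!*[p∸k]!≡p! : (p C k) ℕ.* (k ! ℕ.* (p ∸ k) !) ≡ p !
  C*k!*[p∸k]!≡p! = trans (cong (ℕ._* (k ! ℕ.* (p ∸ k) !)) (nCk≡n!/k![n-k]! k≤p))
                         (m/n*n≡m {{ℕ._!*_!≢0 k (p ∸ k)}} (k![n∸k]!∣n! k≤p))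
  n∣n! : ∀ {n} → 0 ℕ.< n → n ∣ n !
  n∣n! {suc n} _ = m∣m*n (n !)
  p∣C*k!*[p∸k]! : p ∣ (p C k) ℕ.* (k ! ℕ.* (p ∸ k) !)
  p∣C*k!*[p∸k]! = subst (p ∣_) (sym C*k!*[p∸k]!≡p!) (n∣n! (ℕ.<-trans 0<k k<p))
... | inj₁ p∣C = p∣C
... | inj₂ p∣k!*[p∸k]! with euclidsLemma (k !) ((p ∸ k) !) p-prime p∣k!*[p∸k]!
...   | inj₁ p∣k! = ⊥-elim (prime∤! p-prime k k<p p∣k!)
...   | inj₂ p∣[p∸k]! = ⊥-elim (prime∤! p-prime (p ∸ k) (ℕ.∸-monoʳ-< 0<k (ℕ.<⇒≤ k<p)) p∣[p∸k]!)

module FiniteFieldProperties {n : ℕ} (F : FiniteField n) where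
  open FiniteField F public
  open IntegerCoefficientSolver isCommutativeRing public using (ι; ι-+; ι-*; solve; _:=_; _:+_; _:*_; _:-_; :-_; con)
  open CommutativeRing (IntegerCoefficientSolver.ring isCommutativeRing) public
    using (+-assoc; +-comm; +-identityˡ; +-identityʳ; *-assoc; *-comm; *-identityˡ; *-identityʳ;
           zeroˡ; zeroʳ; -‿inverseʳ; +-commutativeMonoid; *-commutativeMonoid; semiring)
  open ≡-Reasoning

  module Sum = CommutativeMonoidSum +-commutativeMonoid
  module Product = CommutativeMonoidSum *-commutativeMonoid

  infixl 6 _-_
  _-_ : K → K → K
  x - y = x + - y

  element : Fin n → K
  element = Inverse.to card

  index : K → Fin n
  index = Inverse.from card

  element-index : ∀ x → element (index x) ≡ x
  element-index = Inverse.strictlyInverseˡ card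

  index-element : ∀ i → index (element i) ≡ i
  index-element = Inverse.strictlyInverseʳ card

  element-injective : ∀ {i j} → element i ≡ element j → i ≡ j
  element-injective {i} {j} eq = trans (sym (index-element i)) (trans (cong index eq) (index-element j))

  index-injective : ∀ {x y} → index x ≡ index y → x ≡ y
  index-injective {x} {y} eq = trans (sym (element-index x)) (trans (cong element eq) (element-index y))

  infix 4 _≟_
  _≟_ : DecidableEquality K
  x ≟ y = map′ index-injective (cong index) (index x Fin.≟ index y)

  1≢0 : 1# ≢ 0#
  1≢0 eq = 0≢1 (sym eq)

  x-y≡0⇒x≡y : ∀ {x y} → x - y ≡ 0# → x ≡ y
  x-y≡0⇒x≡y {x} {y} eq = begin
    x              ≡⟨ solve 2 (λ x y → x := (x :- y) :+ y) refl x y ⟩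
    (x - y) + y    ≡⟨ cong (_+ y) eq ⟩
    0# + y         ≡⟨ +-identityˡ y ⟩
    y              ∎

  x+y≡0⇒y≡-x : ∀ {x y} → x + y ≡ 0# → y ≡ - x
  x+y≡0⇒y≡-x {x} {y} eq = begin
    y              ≡⟨ solve 2 (λ x y → y := (x :+ y) :- x) refl x y ⟩
    (x + y) - x    ≡⟨ cong (_- x) eq ⟩
    0# - x         ≡⟨ +-identityˡ (- x) ⟩
    - x            ∎

  *-cancelˡ : ∀ {x y z} → x ≢ 0# → x * y ≡ x * z → y ≡ z
  *-cancelˡ {x} {y} {z} x≢0 xy≡xz = begin
    y                ≡⟨ sym (*-identityˡ y) ⟩
    1# * y           ≡⟨ cong (_* y) (sym x⁻¹x≡1) ⟩
    (x⁻¹ * x) * y    ≡⟨ *-assoc x⁻¹ x y ⟩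
    x⁻¹ * (x * y)    ≡⟨ cong (x⁻¹ *_) xy≡xz ⟩
    x⁻¹ * (x * z)    ≡⟨ sym (*-assoc x⁻¹ x z) ⟩
    (x⁻¹ * x) * z    ≡⟨ cong (_* z) x⁻¹x≡1 ⟩
    1# * z           ≡⟨ *-identityˡ z ⟩
    z                ∎
    where
    x⁻¹ = proj₁ (inv x x≢0)
    x⁻¹x≡1 = trans (*-comm x⁻¹ x) (proj₂ (inv x x≢0))

  x*y≡0⇒x≡0∨y≡0 : ∀ x y → x * y ≡ 0# → x ≡ 0# ⊎ y ≡ 0#
  x*y≡0⇒x≡0∨y≡0 x y eq with x ≟ 0#
  ... | yes x≡0 = inj₁ x≡0
  ... | no x≢0 = inj₂ (*-cancelˡ x≢0 (trans eq (sym (zeroʳ x))))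

  x≢0∧y≢0⇒x*y≢0 : ∀ {x y} → x ≢ 0# → y ≢ 0# → x * y ≢ 0#
  x≢0∧y≢0⇒x*y≢0 {x} {y} x≢0 y≢0 eq = [ x≢0 , y≢0 ]′ (x*y≡0⇒x≡0∨y≡0 x y eq)

  ^ᶠ-distribˡ-+-* : ∀ x a b → x ^ᶠ (a ℕ.+ b) ≡ x ^ᶠ a * x ^ᶠ b
  ^ᶠ-distribˡ-+-* x zero b = sym (*-identityˡ _)
  ^ᶠ-distribˡ-+-* x (suc a) b = trans (cong (x *_) (^ᶠ-distribˡ-+-* x a b)) (sym (*-assoc _ _ _))

  ^ᶠ-distribʳ-* : ∀ x y a → (x * y) ^ᶠ a ≡ x ^ᶠ a * y ^ᶠ a
  ^ᶠ-distribʳ-* x y zero = sym (*-identityˡ 1#)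
  ^ᶠ-distribʳ-* x y (suc a) = begin
    (x * y) * (x * y) ^ᶠ a         ≡⟨ cong ((x * y) *_) (^ᶠ-distribʳ-* x y a) ⟩
    (x * y) * (x ^ᶠ a * y ^ᶠ a)    ≡⟨ solve 4 (λ x y u v → (x :* y) :* (u :* v) := (x :* u) :* (y :* v)) refl x y (x ^ᶠ a) (y ^ᶠ a) ⟩
    (x * x ^ᶠ a) * (y * y ^ᶠ a)    ∎

  1^ᶠ : ∀ a → 1# ^ᶠ a ≡ 1#
  1^ᶠ zero = refl
  1^ᶠ (suc a) = trans (*-identityˡ _) (1^ᶠ a)

  0^ᶠ≡0 : ∀ {a} → a ≢ 0 → 0# ^ᶠ a ≡ 0#
  0^ᶠ≡0 {zero} a≢0 = ⊥-elim (a≢0 refl)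
  0^ᶠ≡0 {suc a} _ = zeroˡ _

  ^ᶠ-*-assoc : ∀ x a b → (x ^ᶠ a) ^ᶠ b ≡ x ^ᶠ (a ℕ.* b)
  ^ᶠ-*-assoc x zero b = 1^ᶠ b
  ^ᶠ-*-assoc x (suc a) b = begin
    (x * x ^ᶠ a) ^ᶠ b            ≡⟨ ^ᶠ-distribʳ-* x (x ^ᶠ a) b ⟩
    x ^ᶠ b * (x ^ᶠ a) ^ᶠ b       ≡⟨ cong (x ^ᶠ b *_) (^ᶠ-*-assoc x a b) ⟩
    x ^ᶠ b * x ^ᶠ (a ℕ.* b)      ≡⟨ sym (^ᶠ-distribˡ-+-* x b (a ℕ.* b)) ⟩
    x ^ᶠ (b ℕ.+ a ℕ.* b)         ∎

  x≢0⇒x^ᶠa≢0 : ∀ {x} a → x ≢ 0# → x ^ᶠ a ≢ 0#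
  x≢0⇒x^ᶠa≢0 zero x≢0 = 1≢0
  x≢0⇒x^ᶠa≢0 (suc a) x≢0 = x≢0∧y≢0⇒x*y≢0 x≢0 (x≢0⇒x^ᶠa≢0 a x≢0)

  x^ᶠa≡0⇒x≡0 : ∀ {x} a → x ^ᶠ a ≡ 0# → x ≡ 0#
  x^ᶠa≡0⇒x≡0 {x} a eq with x ≟ 0#
  ... | yes x≡0 = x≡0
  ... | no x≢0 = ⊥-elim (x≢0⇒x^ᶠa≢0 a x≢0 eq)

  ι-^ : ∀ a b → ι (a ℕ.^ b) ≡ ι a ^ᶠ b
  ι-^ a zero = refl
  ι-^ a (suc b) = trans (ι-* a (a ℕ.^ b)) (cong (ι a *_) (ι-^ a b))

  indexPermutation : (σ σ⁻¹ : K → K) → (∀ x → σ (σ⁻¹ x) ≡ x) → (∀ x → σ⁻¹ (σ x) ≡ x) → Permutation n n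
  indexPermutation σ σ⁻¹ σσ⁻¹ σ⁻¹σ = Perm.permutation (λ i → index (σ (element i))) (λ i → index (σ⁻¹ (element i)))
    (λ i → trans (cong (index ∘ σ) (element-index _)) (trans (cong index (σσ⁻¹ _)) (index-element i)))
    (λ i → trans (cong (index ∘ σ⁻¹) (element-index _)) (trans (cong index (σ⁻¹σ _)) (index-element i)))

  module _ (σ σ⁻¹ : K → K) (σσ⁻¹ : ∀ x → σ (σ⁻¹ x) ≡ x) (σ⁻¹σ : ∀ x → σ⁻¹ (σ x) ≡ x) (g : K → K) where
    private
      π = indexPermutation σ σ⁻¹ σσ⁻¹ σ⁻¹σ

    sum-reindex : Sum.sum {n} (g ∘ element) ≡ Sum.sum {n} (g ∘ σ ∘ element)
    sum-reindex = trans (Sum.sum-permute (g ∘ element) π) (Sum.sum-cong-≗ {n} (λ i → cong g (element-index _)))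

    product-reindex : Product.sum {n} (g ∘ element) ≡ Product.sum {n} (g ∘ σ ∘ element)
    product-reindex = trans (Product.sum-permute (g ∘ element) π) (Product.sum-cong-≗ {n} (λ i → cong g (element-index _)))

  sum-1# : ∀ m → Sum.sum {m} (λ _ → 1#) ≡ ι m
  sum-1# zero = refl
  sum-1# (suc m) = trans (cong (1# +_) (sum-1# m)) (sym (ι-+ 1 m))

  ι-n≡0 : ι n ≡ 0#
  ι-n≡0 = begin
    ι n                   ≡⟨ solve 2 (λ S c → c := (S :+ c) :- S) refl S (ι n) ⟩
    (S + ι n) - S         ≡⟨ cong (λ c → (S + c) - S) (sym (sum-1# n)) ⟩
    (S + Sum.sum {n} (λ _ → 1#)) - S ≡⟨ cong (_- S) (sym (Sum.∑-distrib-+ element (λ _ → 1#))) ⟩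
    Sum.sum {n} (λ i → element i + 1#) - S ≡⟨ cong (_- S) (sym (sum-reindex (_+ 1#) (_- 1#) shift-back shift-forth id)) ⟩
    S - S                 ≡⟨ -‿inverseʳ S ⟩
    0#                    ∎
    where
    S = Sum.sum {n} element
    shift-back : ∀ x → (x - 1#) + 1# ≡ x
    shift-back = solve 1 (λ x → (x :- con (ℤ.+ 1)) :+ con (ℤ.+ 1) := x) refl
    shift-forth : ∀ x → (x + 1#) - 1# ≡ x
    shift-forth = solve 1 (λ x → (x :+ con (ℤ.+ 1)) :- con (ℤ.+ 1) := x) refl

  n≡2+[n∸2] : n ≡ suc (suc (n ∸ 2))
  n≡2+[n∸2] = two-distinct (index 0#) (index 1#) (0≢1 ∘ index-injective)
    where
    two-distinct : ∀ {m} (i j : Fin m) → i ≢ j → m ≡ suc (suc (m ∸ 2))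
    two-distinct {suc zero} Fin.zero Fin.zero i≢j = ⊥-elim (i≢j refl)
    two-distinct {suc (suc m)} _ _ _ = refl

  unlessZero : K → K → K
  unlessZero x a with x ≟ 0#
  ... | yes _ = 1#
  ... | no _ = a

  unlessZero-≡0 : ∀ {x} a → x ≡ 0# → unlessZero x a ≡ 1#
  unlessZero-≡0 {x} a x≡0 with x ≟ 0#
  ... | yes _ = refl
  ... | no x≢0 = ⊥-elim (x≢0 x≡0)

  unlessZero-≢0 : ∀ {x} a → x ≢ 0# → unlessZero x a ≡ a
  unlessZero-≢0 {x} a x≢0 with x ≟ 0#
  ... | yes x≡0 = ⊥-elim (x≢0 x≡0)
  ... | no _ = refl

  unlessZero-self-≢0 : ∀ x → unlessZero x x ≢ 0#
  unlessZero-self-≢0 x with x ≟ 0#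
  ... | yes _ = 1≢0
  ... | no x≢0 = x≢0

  unlessZero-self-* : ∀ {a} → a ≢ 0# → ∀ x → unlessZero (a * x) (a * x) ≡ unlessZero x a * unlessZero x x
  unlessZero-self-* {a} a≢0 x with x ≟ 0#
  ... | yes x≡0 = trans (unlessZero-≡0 _ (trans (cong (a *_) x≡0) (zeroʳ a))) (sym (*-identityˡ 1#))
  ... | no x≢0 = unlessZero-≢0 _ (x≢0∧y≢0⇒x*y≢0 a≢0 x≢0)

  product-≢0 : ∀ {m} (t : Fin m → K) → (∀ i → t i ≢ 0#) → Product.sum t ≢ 0#
  product-≢0 {zero} t t≢0 = 1≢0
  product-≢0 {suc m} t t≢0 = x≢0∧y≢0⇒x*y≢0 (t≢0 Fin.zero) (product-≢0 (t ∘ Fin.suc) (t≢0 ∘ Fin.suc))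

  product-replicate : ∀ m a → Product.sum {m} (λ _ → a) ≡ a ^ᶠ m
  product-replicate zero a = refl
  product-replicate (suc m) a = cong (a *_) (product-replicate m a)

  product-one-except : ∀ {m} (t : Fin m → K) {a} i → t i ≡ 1# → (∀ j → j ≢ i → t j ≡ a) →
                       a * Product.sum t ≡ a ^ᶠ m
  product-one-except {suc m} t {a} i tᵢ≡1 tⱼ≡a = cong (a *_) (begin
    Product.sum t                            ≡⟨ Product.sum-remove t ⟩
    t i * Product.sum (removeAt t i)         ≡⟨ cong₂ _*_ tᵢ≡1 (Product.sum-cong-≗ {m} (λ j → tⱼ≡a _ (Fin.punchInᵢ≢i i j))) ⟩
    1# * Product.sum {m} (λ _ → a)           ≡⟨ *-identityˡ _ ⟩
    Product.sum {m} (λ _ → a)                ≡⟨ product-replicate m a ⟩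
    a ^ᶠ m                                   ∎)

  x^ᶠn≡x : ∀ a → a ^ᶠ n ≡ a
  x^ᶠn≡x a with a ≟ 0#
  ... | yes a≡0 = subst (λ x → x ^ᶠ n ≡ x) (sym a≡0) (0^ᶠ≡0 (λ n≡0 → ℕ.0≢1+n (trans (sym n≡0) n≡2+[n∸2])))
  ... | no a≢0 = begin
    a ^ᶠ n           ≡⟨ sym (product-one-except (λ i → unlessZero (element i) a) (index 0#)
                              (unlessZero-≡0 a (element-index 0#))
                              (λ j j≢0 → unlessZero-≢0 a (λ eⱼ≡0 → j≢0 (element-injective (trans eⱼ≡0 (sym (element-index 0#))))))) ⟩
    a * Χ            ≡⟨ cong (a *_) Χ≡1 ⟩
    a * 1#           ≡⟨ *-identityʳ a ⟩
    a                ∎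
    where
    a⁻¹ = proj₁ (inv a a≢0)
    aa⁻¹≡1 = proj₂ (inv a a≢0)
    Χ Ψ : K
    Χ = Product.sum {n} (λ i → unlessZero (element i) a)
    Ψ = Product.sum {n} (λ i → unlessZero (element i) (element i))
    Ψ≡ΧΨ : Ψ ≡ Χ * Ψ
    Ψ≡ΧΨ = begin
      Ψ ≡⟨ product-reindex (a *_) (a⁻¹ *_)
             (λ x → trans (sym (*-assoc a a⁻¹ x)) (trans (cong (_* x) aa⁻¹≡1) (*-identityˡ x)))
             (λ x → trans (sym (*-assoc a⁻¹ a x)) (trans (cong (_* x) (trans (*-comm a⁻¹ a) aa⁻¹≡1)) (*-identityˡ x)))
             (λ x → unlessZero x x) ⟩
      Product.sum {n} (λ i → unlessZero (a * element i) (a * element i)) ≡⟨ Product.sum-cong-≗ {n} (unlessZero-self-* a≢0 ∘ element) ⟩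
      Product.sum {n} (λ i → unlessZero (element i) a * unlessZero (element i) (element i)) ≡⟨ Product.∑-distrib-+ (λ i → unlessZero (element i) a) _ ⟩
      Χ * Ψ ∎
    Χ≡1 : Χ ≡ 1#
    Χ≡1 = *-cancelˡ (product-≢0 _ (unlessZero-self-≢0 ∘ element))
            (trans (*-comm Ψ Χ) (trans (sym Ψ≡ΧΨ) (sym (*-identityʳ Ψ))))

  private
    open SemiringExp semiring using () renaming (_^_ to _^ˢ_)
    open SemiringMult semiring using () renaming (_×_ to _×ˢ_)

    ^ˢ≡^ᶠ : ∀ x m → x ^ˢ m ≡ x ^ᶠ m
    ^ˢ≡^ᶠ x zero = refl
    ^ˢ≡^ᶠ x (suc m) = cong (x *_) (^ˢ≡^ᶠ x m)

    ×ˢ≡ι* : ∀ m z → m ×ˢ z ≡ ι m * z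
    ×ˢ≡ι* zero z = sym (zeroˡ z)
    ×ˢ≡ι* (suc m) z = begin
      z + m ×ˢ z        ≡⟨ cong (z +_) (×ˢ≡ι* m z) ⟩
      z + ι m * z       ≡⟨ solve 2 (λ z c → z :+ c :* z := (con (ℤ.+ 1) :+ c) :* z) refl z (ι m) ⟩
      (1# + ι m) * z    ≡⟨ cong (_* z) (sym (ι-+ 1 m)) ⟩
      ι (suc m) * z     ∎

  binomialTerm-inner≡0 : ∀ {p} → Prime (suc p) → ι (suc p) ≡ 0# → ∀ x y i →
                         BinomialTheorem.binomialTerm semiring x y (suc p) (Fin.suc (Fin.inject₁ i)) ≡ 0#
  binomialTerm-inner≡0 {p} p-prime ι-p≡0 x y i
    with prime∣C p-prime (ℕ.s≤s ℕ.z≤n) (ℕ.s≤s (subst (ℕ._< p) (sym (Fin.toℕ-inject₁ i)) (Fin.toℕ<n i)))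
  ... | divides d C≡d*p = begin
    (suc p C k) ×ˢ b                        ≡⟨ ×ˢ≡ι* (suc p C k) b ⟩
    ι (suc p C k) * b                       ≡⟨ cong (λ c → ι c * b) C≡d*p ⟩
    ι (d ℕ.* suc p) * b                     ≡⟨ cong (_* b) (ι-* d (suc p)) ⟩
    (ι d * ι (suc p)) * b                   ≡⟨ cong (λ c → (ι d * c) * b) ι-p≡0 ⟩
    (ι d * 0#) * b                          ≡⟨ solve 2 (λ c b → (c :* con (ℤ.+ 0)) :* b := con (ℤ.+ 0)) refl (ι d) b ⟩
    0#                                      ∎
    where
    k = suc (Fin.toℕ (Fin.inject₁ i))
    b = x ^ˢ k * y ^ˢ (suc p ∸ k)

  ^ᶠ-prime-homo-+ : ∀ {p} → Prime p → ι p ≡ 0# → ∀ x y → (x + y) ^ᶠ p ≡ x ^ᶠ p + y ^ᶠ p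
  ^ᶠ-prime-homo-+ {zero} p-prime = ⊥-elim (NonTrivial.nonTrivial (prime⇒nonTrivial p-prime))
  ^ᶠ-prime-homo-+ {suc p} p-prime ι-p≡0 x y = begin
    (x + y) ^ᶠ suc p                               ≡⟨ sym (^ˢ≡^ᶠ (x + y) (suc p)) ⟩
    (x + y) ^ˢ suc p                               ≡⟨ Binomial.theorem (*-comm x y) (suc p) ⟩
    Binomial.binomialExpansion (suc p)              ≡⟨ cong (t Fin.zero +_) (Sum.sum-init-last (t ∘ Fin.suc)) ⟩
    t Fin.zero + (Sum.sum {p} (t ∘ Fin.suc ∘ Fin.inject₁) + t (Fin.suc (Fin.fromℕ p)))
        ≡⟨ cong₂ (λ a b → t Fin.zero + (a + b)) (Sum.sum-cong-≗ {p} (binomialTerm-inner≡0 p-prime ι-p≡0 x y)) last≡x^ᶠp ⟩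
    t Fin.zero + (Sum.sum {p} (λ _ → 0#) + x ^ᶠ suc p)
        ≡⟨ cong₂ (λ a b → a + (b + x ^ᶠ suc p)) first≡y^ᶠp (Sum.sum-replicate-zero p) ⟩
    y ^ᶠ suc p + (0# + x ^ᶠ suc p)                 ≡⟨ solve 2 (λ a b → b :+ (con (ℤ.+ 0) :+ a) := a :+ b) refl (x ^ᶠ suc p) (y ^ᶠ suc p) ⟩
    x ^ᶠ suc p + y ^ᶠ suc p                        ∎
    where
    module Binomial = BinomialTheorem semiring x y
    t = Binomial.binomialTerm (suc p)
    T : ℕ → K
    T k = (suc p C k) ×ˢ (x ^ˢ k * y ^ˢ (suc p ∸ k))
    first≡y^ᶠp : t Fin.zero ≡ y ^ᶠ suc p
    first≡y^ᶠp = trans (+-identityʳ _) (trans (*-identityˡ _) (^ˢ≡^ᶠ y (suc p)))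
    last≡x^ᶠp : t (Fin.suc (Fin.fromℕ p)) ≡ x ^ᶠ suc p
    last≡x^ᶠp = begin
      T (suc (Fin.toℕ (Fin.fromℕ p)))       ≡⟨ cong (T ∘ suc) (Fin.toℕ-fromℕ p) ⟩
      (suc p C suc p) ×ˢ (x ^ˢ suc p * y ^ˢ (p ∸ p)) ≡⟨ cong₂ (λ c k → c ×ˢ (x ^ˢ suc p * y ^ˢ k)) (nCn≡1 (suc p)) (ℕ.n∸n≡0 p) ⟩
      x ^ˢ suc p * 1# + 0#                  ≡⟨ trans (+-identityʳ _) (*-identityʳ _) ⟩
      x ^ˢ suc p                            ≡⟨ ^ˢ≡^ᶠ x (suc p) ⟩
      x ^ᶠ suc p                            ∎

  ^ᶠ-primePower-homo-+ : ∀ {p} → Prime p → ι p ≡ 0# → ∀ k x y → (x + y) ^ᶠ (p ℕ.^ k) ≡ x ^ᶠ (p ℕ.^ k) + y ^ᶠ (p ℕ.^ k)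
  ^ᶠ-primePower-homo-+ p-prime ι-p≡0 zero x y = solve 2 (λ x y → (x :+ y) :* con (ℤ.+ 1) := x :* con (ℤ.+ 1) :+ y :* con (ℤ.+ 1)) refl x y
  ^ᶠ-primePower-homo-+ {p} p-prime ι-p≡0 (suc k) x y = begin
    (x + y) ^ᶠ (p ℕ.* p ℕ.^ k)                        ≡⟨ sym (^ᶠ-*-assoc (x + y) p (p ℕ.^ k)) ⟩
    ((x + y) ^ᶠ p) ^ᶠ (p ℕ.^ k)                       ≡⟨ cong (_^ᶠ (p ℕ.^ k)) (^ᶠ-prime-homo-+ p-prime ι-p≡0 x y) ⟩
    (x ^ᶠ p + y ^ᶠ p) ^ᶠ (p ℕ.^ k)                    ≡⟨ ^ᶠ-primePower-homo-+ p-prime ι-p≡0 k (x ^ᶠ p) (y ^ᶠ p) ⟩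
    (x ^ᶠ p) ^ᶠ (p ℕ.^ k) + (y ^ᶠ p) ^ᶠ (p ℕ.^ k)     ≡⟨ cong₂ _+_ (^ᶠ-*-assoc x p _) (^ᶠ-*-assoc y p _) ⟩
    x ^ᶠ (p ℕ.* p ℕ.^ k) + y ^ᶠ (p ℕ.* p ℕ.^ k)       ∎

  quotient : K → List K → List K
  quotient r [] = []
  quotient r (c ∷ cs) = evalPoly (c ∷ cs) r ∷ quotient r cs

  length-quotient : ∀ r cs → length (quotient r cs) ≡ length cs
  length-quotient r [] = refl
  length-quotient r (c ∷ cs) = cong suc (length-quotient r cs)

  evalPoly-quotient : ∀ r c cs y → evalPoly (c ∷ cs) y ≡ (y - r) * evalPoly (quotient r cs) y + evalPoly (c ∷ cs) r
  evalPoly-quotient r c [] y = solve 3 (λ c r y → c :+ y :* con (ℤ.+ 0) := (y :- r) :* con (ℤ.+ 0) :+ (c :+ r :* con (ℤ.+ 0))) refl c r y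
  evalPoly-quotient r c (d ∷ ds) y = begin
    c + y * evalPoly (d ∷ ds) y                  ≡⟨ cong (λ e → c + y * e) (evalPoly-quotient r d ds y) ⟩
    c + y * ((y - r) * Q + P)
      ≡⟨ solve 5 (λ c y r Q P → c :+ y :* ((y :- r) :* Q :+ P) := (y :- r) :* (P :+ y :* Q) :+ (c :+ r :* P)) refl c y r Q P ⟩
    (y - r) * (P + y * Q) + (c + r * P)          ∎
    where
    Q = evalPoly (quotient r ds) y
    P = evalPoly (d ∷ ds) r

  quotient-zero⇒zero : ∀ r c cs → All (_≡ 0#) (quotient r cs) → evalPoly (c ∷ cs) r ≡ 0# → All (_≡ 0#) (c ∷ cs)
  quotient-zero⇒zero r c [] [] P[r]≡0 = trans (solve 2 (λ c r → c := c :+ r :* con (ℤ.+ 0)) refl c r) P[r]≡0 ∷ []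
  quotient-zero⇒zero r c (d ∷ ds) (P′[r]≡0 ∷ rest) P[r]≡0 =
    trans (solve 2 (λ c r → c := c :+ r :* con (ℤ.+ 0)) refl c r) (trans (cong (λ e → c + r * e) (sym P′[r]≡0)) P[r]≡0)
    ∷ quotient-zero⇒zero r d ds rest P′[r]≡0

  quotient-root : ∀ {r y} c cs → evalPoly (c ∷ cs) r ≡ 0# → evalPoly (c ∷ cs) y ≡ 0# → y ≢ r →
                  evalPoly (quotient r cs) y ≡ 0#
  quotient-root {r} {y} c cs P[r]≡0 P[y]≡0 y≢r =
    [ (λ y-r≡0 → ⊥-elim (y≢r (x-y≡0⇒x≡y y-r≡0))) , id ]′ (x*y≡0⇒x≡0∨y≡0 (y - r) Q[y] (begin
      (y - r) * Q[y]                         ≡⟨ sym (+-identityʳ _) ⟩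
      (y - r) * Q[y] + 0#                    ≡⟨ cong ((y - r) * Q[y] +_) (sym P[r]≡0) ⟩
      (y - r) * Q[y] + evalPoly (c ∷ cs) r   ≡⟨ sym (evalPoly-quotient r c cs y) ⟩
      evalPoly (c ∷ cs) y                    ≡⟨ P[y]≡0 ⟩
      0#                                     ∎))
    where
    Q[y] = evalPoly (quotient r cs) y

  roots⇒zero : ∀ d (P : List K) → length P ≡ d → (ρ : Fin d → K) → Injective _≡_ _≡_ ρ →
               (∀ i → evalPoly P (ρ i) ≡ 0#) → All (_≡ 0#) P
  roots⇒zero zero [] _ ρ ρ-injective roots = []
  roots⇒zero (suc d) (c ∷ cs) |P|≡1+d ρ ρ-injective roots =
    quotient-zero⇒zero (ρ Fin.zero) c cs
      (roots⇒zero d (quotient (ρ Fin.zero) cs) (trans (length-quotient _ cs) (ℕ.suc-injective |P|≡1+d))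
                  (ρ ∘ Fin.suc) (Fin.suc-injective ∘ ρ-injective)
                  (λ i → quotient-root c cs (roots Fin.zero) (roots (Fin.suc i)) (Fin.0≢1+n ∘ sym ∘ ρ-injective)))
      (roots Fin.zero)

  n∸1≡1+[n∸2] : n ∸ 1 ≡ suc (n ∸ 2)
  n∸1≡1+[n∸2] = cong (_∸ 1) n≡2+[n∸2]

  x≢0⇒x^ᶠ[n∸1]≡1 : ∀ {x} → x ≢ 0# → x ^ᶠ (n ∸ 1) ≡ 1#
  x≢0⇒x^ᶠ[n∸1]≡1 {x} x≢0 = *-cancelˡ x≢0 (begin
    x * x ^ᶠ (n ∸ 1)   ≡⟨ cong (λ k → x ^ᶠ suc k) n∸1≡1+[n∸2] ⟩
    x ^ᶠ suc (suc (n ∸ 2)) ≡⟨ subst (λ m → x ^ᶠ m ≡ x) n≡2+[n∸2] (x^ᶠn≡x x) ⟩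
    x                  ≡⟨ sym (*-identityʳ x) ⟩
    x * 1#             ∎)

  sum-single : ∀ {m} (u : Fin m → K) i → (∀ j → j ≢ i → u j ≡ 0#) → Sum.sum u ≡ u i
  sum-single {suc m} u i uⱼ≡0 = begin
    Sum.sum u                          ≡⟨ Sum.sum-remove u ⟩
    u i + Sum.sum (removeAt u i)       ≡⟨ cong (u i +_) (Sum.sum-cong-≗ {m} (λ j → uⱼ≡0 _ (Fin.punchInᵢ≢i i j))) ⟩
    u i + Sum.sum {m} (λ _ → 0#)       ≡⟨ cong (u i +_) (Sum.sum-replicate-zero m) ⟩
    u i + 0#                           ≡⟨ +-identityʳ (u i) ⟩
    u i                                ∎

  infixl 6 _⊕_
  _⊕_ : List K → List K → List K
  [] ⊕ Q = Q
  (a ∷ P) ⊕ [] = a ∷ P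
  (a ∷ P) ⊕ (b ∷ Q) = (a + b) ∷ (P ⊕ Q)

  evalPoly-⊕ : ∀ P Q y → evalPoly (P ⊕ Q) y ≡ evalPoly P y + evalPoly Q y
  evalPoly-⊕ [] Q y = sym (+-identityˡ _)
  evalPoly-⊕ (a ∷ P) [] y = sym (+-identityʳ _)
  evalPoly-⊕ (a ∷ P) (b ∷ Q) y = trans (cong (λ e → (a + b) + y * e) (evalPoly-⊕ P Q y))
    (solve 5 (λ a b y u v → (a :+ b) :+ y :* (u :+ v) := (a :+ y :* u) :+ (b :+ y :* v)) refl a b y (evalPoly P y) (evalPoly Q y))

  scale : K → List K → List K
  scale c = List.map (c *_)

  evalPoly-scale : ∀ c P y → evalPoly (scale c P) y ≡ c * evalPoly P y
  evalPoly-scale c [] y = sym (zeroʳ c)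
  evalPoly-scale c (a ∷ P) y = trans (cong (λ e → c * a + y * e) (evalPoly-scale c P y))
    (solve 4 (λ c a y u → c :* a :+ y :* (c :* u) := c :* (a :+ y :* u)) refl c a y (evalPoly P y))

  shiftedPower : K → ℕ → List K
  shiftedPower a zero = 1# ∷ []
  shiftedPower a (suc k) = (0# ∷ P) ⊕ scale (- a) P
    where
    P = shiftedPower a k

  evalPoly-shiftedPower : ∀ a k y → evalPoly (shiftedPower a k) y ≡ (y - a) ^ᶠ k
  evalPoly-shiftedPower a zero y = solve 1 (λ y → con (ℤ.+ 1) :+ y :* con (ℤ.+ 0) := con (ℤ.+ 1)) refl y
  evalPoly-shiftedPower a (suc k) y = begin
    evalPoly ((0# ∷ P) ⊕ scale (- a) P) y        ≡⟨ evalPoly-⊕ (0# ∷ P) (scale (- a) P) y ⟩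
    (0# + y * evalPoly P y) + evalPoly (scale (- a) P) y ≡⟨ cong ((0# + y * evalPoly P y) +_) (evalPoly-scale (- a) P y) ⟩
    (0# + y * evalPoly P y) + - a * evalPoly P y ≡⟨ solve 3 (λ a y u → (con (ℤ.+ 0) :+ y :* u) :+ (:- a) :* u := (y :- a) :* u) refl a y (evalPoly P y) ⟩
    (y - a) * evalPoly P y                       ≡⟨ cong ((y - a) *_) (evalPoly-shiftedPower a k y) ⟩
    (y - a) * (y - a) ^ᶠ k                       ∎
    where
    P = shiftedPower a k

  indicator : K → List K
  indicator a = (1# ∷ []) ⊕ scale (- 1#) (shiftedPower a (n ∸ 1))

  evalPoly-indicator : ∀ a y → evalPoly (indicator a) y ≡ 1# - (y - a) ^ᶠ (n ∸ 1)
  evalPoly-indicator a y = begin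
    evalPoly ((1# ∷ []) ⊕ scale (- 1#) P) y          ≡⟨ evalPoly-⊕ (1# ∷ []) (scale (- 1#) P) y ⟩
    (1# + y * 0#) + evalPoly (scale (- 1#) P) y      ≡⟨ cong ((1# + y * 0#) +_) (evalPoly-scale (- 1#) P y) ⟩
    (1# + y * 0#) + - 1# * evalPoly P y              ≡⟨ cong (λ z → (1# + y * 0#) + - 1# * z) (evalPoly-shiftedPower a (n ∸ 1) y) ⟩
    (1# + y * 0#) + - 1# * (y - a) ^ᶠ (n ∸ 1)
      ≡⟨ solve 2 (λ y u → (con (ℤ.+ 1) :+ y :* con (ℤ.+ 0)) :+ :- con (ℤ.+ 1) :* u := con (ℤ.+ 1) :- u) refl y _ ⟩
    1# - (y - a) ^ᶠ (n ∸ 1)                          ∎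
    where
    P = shiftedPower a (n ∸ 1)

  evalPoly-indicator-≡ : ∀ a → evalPoly (indicator a) a ≡ 1#
  evalPoly-indicator-≡ a = begin
    evalPoly (indicator a) a      ≡⟨ evalPoly-indicator a a ⟩
    1# - (a - a) ^ᶠ (n ∸ 1)       ≡⟨ cong (λ z → 1# - z ^ᶠ (n ∸ 1)) (-‿inverseʳ a) ⟩
    1# - 0# ^ᶠ (n ∸ 1)            ≡⟨ cong (λ z → 1# - z) (0^ᶠ≡0 (λ n∸1≡0 → ℕ.0≢1+n (trans (sym n∸1≡0) n∸1≡1+[n∸2]))) ⟩
    1# - 0#                       ≡⟨ solve 0 (con (ℤ.+ 1) :- con (ℤ.+ 0) := con (ℤ.+ 1)) refl ⟩
    1#                            ∎

  evalPoly-indicator-≢ : ∀ a y → y ≢ a → evalPoly (indicator a) y ≡ 0#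
  evalPoly-indicator-≢ a y y≢a = begin
    evalPoly (indicator a) y      ≡⟨ evalPoly-indicator a y ⟩
    1# - (y - a) ^ᶠ (n ∸ 1)       ≡⟨ cong (λ z → 1# - z) (x≢0⇒x^ᶠ[n∸1]≡1 (y≢a ∘ x-y≡0⇒x≡y)) ⟩
    1# - 1#                       ≡⟨ -‿inverseʳ 1# ⟩
    0#                            ∎

  sumPoly : ∀ {m} → (Fin m → List K) → List K
  sumPoly {zero} Ps = []
  sumPoly {suc m} Ps = Ps Fin.zero ⊕ sumPoly (Ps ∘ Fin.suc)

  evalPoly-sumPoly : ∀ {m} (Ps : Fin m → List K) y → evalPoly (sumPoly Ps) y ≡ Sum.sum (λ i → evalPoly (Ps i) y)
  evalPoly-sumPoly {zero} Ps y = refl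
  evalPoly-sumPoly {suc m} Ps y = trans (evalPoly-⊕ (Ps Fin.zero) (sumPoly (Ps ∘ Fin.suc)) y)
                                        (cong (evalPoly (Ps Fin.zero) y +_) (evalPoly-sumPoly (Ps ∘ Fin.suc) y))

  interpolate : (K → K) → List K
  interpolate v = sumPoly {n} (λ i → scale (v (element i)) (indicator (element i)))

  evalPoly-interpolate : ∀ v y → evalPoly (interpolate v) y ≡ v y
  evalPoly-interpolate v y = begin
    evalPoly (interpolate v) y                               ≡⟨ evalPoly-sumPoly {n} (λ i → scale (v (element i)) (indicator (element i))) y ⟩
    Sum.sum (λ i → evalPoly (scale (v (element i)) (indicator (element i))) y)
                                                             ≡⟨ Sum.sum-cong-≗ {n} (λ i → evalPoly-scale (v (element i)) (indicator (element i)) y) ⟩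
    Sum.sum (λ i → v (element i) * evalPoly (indicator (element i)) y)
                                                             ≡⟨ sum-single (λ i → v (element i) * evalPoly (indicator (element i)) y) (index y) vanish ⟩
    v (element (index y)) * evalPoly (indicator (element (index y))) y ≡⟨ cong (λ a → v a * evalPoly (indicator a) y) (element-index y) ⟩
    v y * evalPoly (indicator y) y                           ≡⟨ cong (v y *_) (evalPoly-indicator-≡ y) ⟩
    v y * 1#                                                 ≡⟨ *-identityʳ (v y) ⟩
    v y                                                      ∎
    where
    vanish : ∀ j → j ≢ index y → v (element j) * evalPoly (indicator (element j)) y ≡ 0#
    vanish j j≢iy = trans (cong (v (element j) *_) (evalPoly-indicator-≢ (element j) y
                            (λ y≡eⱼ → j≢iy (trans (sym (index-element j)) (cong index (sym y≡eⱼ))))))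
                          (zeroʳ _)

  monomial : ℕ → List K
  monomial zero = 1# ∷ []
  monomial (suc t) = 0# ∷ monomial t

  length-monomial : ∀ t → length (monomial t) ≡ suc t
  length-monomial zero = refl
  length-monomial (suc t) = cong suc (length-monomial t)

  evalPoly-monomial : ∀ t y → evalPoly (monomial t) y ≡ y ^ᶠ t
  evalPoly-monomial zero y = solve 1 (λ y → con (ℤ.+ 1) :+ y :* con (ℤ.+ 0) := con (ℤ.+ 1)) refl y
  evalPoly-monomial (suc t) y = trans (+-identityˡ _) (cong (y *_) (evalPoly-monomial t y))

  monomial≢0 : ∀ t → ¬ All (_≡ 0#) (monomial t)
  monomial≢0 zero (1≡0 ∷ []) = 1≢0 1≡0
  monomial≢0 (suc t) (_ ∷ rest) = monomial≢0 t rest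

  -- y^(2+t) - cy has 3 + t coefficients, so it cannot vanish at 3 + t distinct points.
  ∃-x^ᶠ[2+t]≢cx : ∀ t c → 3 ℕ.+ t ℕ.≤ n → ∃ λ y → y ^ᶠ suc (suc t) ≢ c * y
  ∃-x^ᶠ[2+t]≢cx t c 3+t≤n =
    Data.Product.map element id (Fin.¬∀⟶∃¬ n _ (λ i → element i ^ᶠ suc (suc t) ≟ c * element i) not-all-roots)
    where
    P = 0# ∷ - c ∷ monomial t
    root : ∀ {y} → y ^ᶠ suc (suc t) ≡ c * y → evalPoly P y ≡ 0#
    root {y} y^ᶠ[2+t]≡cy = begin
      0# + y * (- c + y * evalPoly (monomial t) y) ≡⟨ cong (λ e → 0# + y * (- c + y * e)) (evalPoly-monomial t y) ⟩
      0# + y * (- c + y * y ^ᶠ t)                  ≡⟨ solve 3 (λ y c u → con (ℤ.+ 0) :+ y :* (:- c :+ y :* u) := y :* (y :* u) :- c :* y) refl y c (y ^ᶠ t) ⟩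
      y ^ᶠ suc (suc t) - c * y                     ≡⟨ cong (_- c * y) y^ᶠ[2+t]≡cy ⟩
      c * y - c * y                                ≡⟨ -‿inverseʳ (c * y) ⟩
      0#                                           ∎
    ρ : Fin (3 ℕ.+ t) → K
    ρ i = element (Fin.inject≤ i 3+t≤n)
    ρ-injective : Injective _≡_ _≡_ ρ
    ρ-injective = Fin.inject≤-injective 3+t≤n 3+t≤n _ _ ∘ element-injective
    not-all-roots : ¬ (∀ i → element i ^ᶠ suc (suc t) ≡ c * element i)
    not-all-roots all-roots = monomial≢0 t (drop-two (roots⇒zero (3 ℕ.+ t) P (cong (suc ∘ suc) (length-monomial t)) ρ ρ-injective
                                                   (λ i → root (all-roots (Fin.inject≤ i 3+t≤n)))))
      where
      drop-two : ∀ {a b cs} → All (_≡ 0#) (a ∷ b ∷ cs) → All (_≡ 0#) cs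
      drop-two (_ ∷ _ ∷ cs≡0) = cs≡0

  factorise : ∀ (σ φ : K → K) → (∀ x x′ → σ x ≡ σ x′ → φ x ≡ φ x′) → ∃ λ v → ∀ x → v (σ x) ≡ φ x
  factorise σ φ φ-respects-σ = v , v∘σ≡φ
    where
    preimage? : ∀ w → Dec (∃ λ i → σ (element i) ≡ w)
    preimage? w = Fin.any? (λ i → σ (element i) ≟ w)
    v : K → K
    v w with preimage? w
    ... | yes (i , _) = φ (element i)
    ... | no _ = 0#
    v∘σ≡φ : ∀ x → v (σ x) ≡ φ x
    v∘σ≡φ x with preimage? (σ x)
    ... | yes (i , σeᵢ≡σx) = φ-respects-σ _ _ σeᵢ≡σx
    ... | no no-preimage = ⊥-elim (no-preimage (index x , cong σ (element-index x)))


module OverFq²Properties (q : ℕ) (q-primePower : IsPrimePower q) (F : FiniteField (q ℕ.^ 2)) where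
  open FiniteFieldProperties F
  open OverFq² q F using (InFq; LinPoly; evalLin; IsPermutation; IsCompInverse)
  open ≡-Reasoning

  ι-q≡0 : ι q ≡ 0#
  ι-q≡0 = x^ᶠa≡0⇒x≡0 2 (trans (sym (ι-^ q 2)) ι-n≡0)

  ^ᶠq-homo-+ : ∀ x y → (x + y) ^ᶠ q ≡ x ^ᶠ q + y ^ᶠ q
  ^ᶠq-homo-+ = frobenius q-primePower
    where
    frobenius : IsPrimePower q → ∀ x y → (x + y) ^ᶠ q ≡ x ^ᶠ q + y ^ᶠ q
    frobenius (p , k , p-prime , _ , q≡p^k) = subst (λ m → ∀ x y → (x + y) ^ᶠ m ≡ x ^ᶠ m + y ^ᶠ m) (sym q≡p^k)
      (^ᶠ-primePower-homo-+ p-prime ι-p≡0 k)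
      where
      ι-p≡0 : ι p ≡ 0#
      ι-p≡0 = x^ᶠa≡0⇒x≡0 k (trans (sym (ι-^ p k)) (trans (cong ι (sym q≡p^k)) ι-q≡0))

  2≤q : 2 ℕ.≤ q
  2≤q = 2≤-of-square q n≡2+[n∸2]
    where
    2≤-of-square : ∀ m {k} → m ℕ.^ 2 ≡ suc (suc k) → 2 ℕ.≤ m
    2≤-of-square (suc (suc m)) _ = ℕ.s≤s (ℕ.s≤s ℕ.z≤n)

  q≡2+[q∸2] : q ≡ suc (suc (q ∸ 2))
  q≡2+[q∸2] = sym (ℕ.m+[n∸m]≡n 2≤q)

  q+1≤q² : 3 ℕ.+ (q ∸ 2) ℕ.≤ q ℕ.^ 2
  q+1≤q² = subst (λ m → 3 ℕ.+ (q ∸ 2) ℕ.≤ m ℕ.^ 2) (sym q≡2+[q∸2]) (3+t≤[2+t]² (q ∸ 2))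
    where
    3+t≤[2+t]² : ∀ t → 3 ℕ.+ t ℕ.≤ (2 ℕ.+ t) ℕ.^ 2
    3+t≤[2+t]² t = subst₂ ℕ._≤_ (ℕ.+-comm (2 ℕ.+ t) 1) (cong ((2 ℕ.+ t) ℕ.*_) (sym (ℕ.*-identityʳ (2 ℕ.+ t))))
                          (ℕ.+-monoʳ-≤ (2 ℕ.+ t) (ℕ.s≤s ℕ.z≤n))

  0^ᶠq≡0 : 0# ^ᶠ q ≡ 0#
  0^ᶠq≡0 = 0^ᶠ≡0 (λ q≡0 → ℕ.0≢1+n (trans (sym q≡0) q≡2+[q∸2]))

  ^ᶠq-homo-neg : ∀ x → (- x) ^ᶠ q ≡ - (x ^ᶠ q)
  ^ᶠq-homo-neg x = x+y≡0⇒y≡-x (begin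
    x ^ᶠ q + (- x) ^ᶠ q   ≡⟨ sym (^ᶠq-homo-+ x (- x)) ⟩
    (x - x) ^ᶠ q         ≡⟨ cong (_^ᶠ q) (-‿inverseʳ x) ⟩
    0# ^ᶠ q              ≡⟨ 0^ᶠq≡0 ⟩
    0#                   ∎)

  ^ᶠq-homo-sub : ∀ x y → (x - y) ^ᶠ q ≡ x ^ᶠ q - y ^ᶠ q
  ^ᶠq-homo-sub x y = trans (^ᶠq-homo-+ x (- y)) (cong (x ^ᶠ q +_) (^ᶠq-homo-neg y))

  ^ᶠq-involutive : ∀ x → (x ^ᶠ q) ^ᶠ q ≡ x
  ^ᶠq-involutive x = trans (^ᶠ-*-assoc x q q) (trans (cong (x ^ᶠ_) (cong (q ℕ.*_) (sym (ℕ.*-identityʳ q)))) (x^ᶠn≡x x))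

  ^ᶠq-*-InFq : ∀ {c} x → InFq c → (c * x) ^ᶠ q ≡ c * x ^ᶠ q
  ^ᶠq-*-InFq {c} x c∈Fq = trans (^ᶠ-distribʳ-* c x q) (cong (_* x ^ᶠ q) c∈Fq)

  s : K → K → K
  s δ x = x ^ᶠ q + δ * x

  s-+ : ∀ δ x y → s δ (x + y) ≡ s δ x + s δ y
  s-+ δ x y = trans (cong (_+ δ * (x + y)) (^ᶠq-homo-+ x y))
    (solve 5 (λ a b d x y → (a :+ b) :+ d :* (x :+ y) := (a :+ d :* x) :+ (b :+ d :* y)) refl (x ^ᶠ q) (y ^ᶠ q) δ x y)

  s-*-InFq : ∀ δ {c} x → InFq c → s δ (c * x) ≡ c * s δ x
  s-*-InFq δ {c} x c∈Fq = trans (cong (_+ δ * (c * x)) (^ᶠq-*-InFq x c∈Fq))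
    (solve 4 (λ c a d x → c :* a :+ d :* (c :* x) := c :* (a :+ d :* x)) refl c (x ^ᶠ q) δ x)

  s-sub : ∀ δ x y → s δ (x - y) ≡ s δ x - s δ y
  s-sub δ x y = trans (cong (_+ δ * (x - y)) (^ᶠq-homo-sub x y))
    (solve 5 (λ a b d x y → (a :- b) :+ d :* (x :- y) := (a :+ d :* x) :- (b :+ d :* y)) refl (x ^ᶠ q) (y ^ᶠ q) δ x y)

  s≡0⇒^ᶠq≡- : ∀ {δ x} → s δ x ≡ 0# → x ^ᶠ q ≡ - (δ * x)
  s≡0⇒^ᶠq≡- {δ} {x} sx≡0 = x+y≡0⇒y≡-x (trans (+-comm (δ * x) (x ^ᶠ q)) sx≡0)

  evalLin-+ : ∀ L x y → evalLin L (x + y) ≡ evalLin L x + evalLin L y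
  evalLin-+ (α₁ , α₀) x y = trans (cong (λ z → α₁ * z + α₀ * (x + y)) (^ᶠq-homo-+ x y))
    (solve 6 (λ a b u v x y → u :* (a :+ b) :+ v :* (x :+ y) := (u :* a :+ v :* x) :+ (u :* b :+ v :* y)) refl (x ^ᶠ q) (y ^ᶠ q) α₁ α₀ x y)

  evalLin-*-InFq : ∀ L {c} x → InFq c → evalLin L (c * x) ≡ c * evalLin L x
  evalLin-*-InFq (α₁ , α₀) {c} x c∈Fq = trans (cong (λ z → α₁ * z + α₀ * (c * x)) (^ᶠq-*-InFq x c∈Fq))
    (solve 5 (λ c a u v x → u :* (c :* a) :+ v :* (c :* x) := c :* (u :* a :+ v :* x)) refl c (x ^ᶠ q) α₁ α₀ x)

  evalLin-0 : ∀ L → evalLin L 0# ≡ 0#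
  evalLin-0 (α₁ , α₀) = trans (cong (λ z → α₁ * z + α₀ * 0#) 0^ᶠq≡0)
    (solve 2 (λ u v → u :* con (ℤ.+ 0) :+ v :* con (ℤ.+ 0) := con (ℤ.+ 0)) refl α₁ α₀)

  ∃-x^ᶠq≢cx : ∀ c → ∃ λ y → y ^ᶠ q ≢ c * y
  ∃-x^ᶠq≢cx c = subst (λ m → ∃ λ y → y ^ᶠ m ≢ c * y) (sym q≡2+[q∸2]) (∃-x^ᶠ[2+t]≢cx (q ∸ 2) c q+1≤q²)

  ∃-nonzero-kernel : ∀ δ → δ ^ᶠ (q ℕ.+ 1) ≡ 1# → ∃ λ k → k ≢ 0# × s δ k ≡ 0#
  ∃-nonzero-kernel δ δ^ᶠ[q+1]≡1 = kernel-element (∃-x^ᶠq≢cx (δ ^ᶠ q))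
    where
    δ^ᶠq*δ≡1 : δ ^ᶠ q * δ ≡ 1#
    δ^ᶠq*δ≡1 = trans (cong (δ ^ᶠ q *_) (sym (*-identityʳ δ))) (trans (sym (^ᶠ-distribˡ-+-* δ q 1)) δ^ᶠ[q+1]≡1)
    kernel-element : (∃ λ y → y ^ᶠ q ≢ δ ^ᶠ q * y) → ∃ λ k → k ≢ 0# × s δ k ≡ 0#
    kernel-element (y , y^ᶠq≢δ^ᶠqy) = k , y^ᶠq≢δ^ᶠqy ∘ x-y≡0⇒x≡y , sk≡0
      where
      k = y ^ᶠ q - δ ^ᶠ q * y
      sk≡0 : s δ k ≡ 0#
      sk≡0 = begin
        k ^ᶠ q + δ * k                                   ≡⟨ cong (_+ δ * k) (^ᶠq-homo-sub (y ^ᶠ q) (δ ^ᶠ q * y)) ⟩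
        ((y ^ᶠ q) ^ᶠ q - (δ ^ᶠ q * y) ^ᶠ q) + δ * k      ≡⟨ cong (λ z → ((y ^ᶠ q) ^ᶠ q - z) + δ * k) (^ᶠ-distribʳ-* (δ ^ᶠ q) y q) ⟩
        ((y ^ᶠ q) ^ᶠ q - (δ ^ᶠ q) ^ᶠ q * y ^ᶠ q) + δ * k ≡⟨ cong₂ (λ a b → (a - b * y ^ᶠ q) + δ * k) (^ᶠq-involutive y) (^ᶠq-involutive δ) ⟩
        (y - δ * y ^ᶠ q) + δ * (y ^ᶠ q - δ ^ᶠ q * y)
          ≡⟨ solve 4 (λ y d a b → (y :- d :* a) :+ d :* (a :- b :* y) := y :- (b :* d) :* y) refl y δ (y ^ᶠ q) (δ ^ᶠ q) ⟩
        y - (δ ^ᶠ q * δ) * y                             ≡⟨ cong (λ z → y - z * y) δ^ᶠq*δ≡1 ⟩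
        y - 1# * y                                       ≡⟨ cong (λ z → y - z) (*-identityˡ y) ⟩
        y - y                                            ≡⟨ -‿inverseʳ y ⟩
        0#                                               ∎

  kernel-multiple : ∀ {δ η e} → η ≢ 0# → s δ η ≡ 0# → s δ e ≡ 0# → ∃ λ t → InFq t × e ≡ t * η
  kernel-multiple {δ} {η} {e} η≢0 sη≡0 se≡0 with inv η η≢0
  ... | η⁻¹ , ηη⁻¹≡1 = t , t∈Fq , sym tη≡e
    where
    t = e * η⁻¹
    tη≡e : t * η ≡ e
    tη≡e = trans (*-assoc e η⁻¹ η) (trans (cong (e *_) (trans (*-comm η⁻¹ η) ηη⁻¹≡1)) (*-identityʳ e))
    t∈Fq : InFq t
    t∈Fq = *-cancelˡ (x≢0⇒x^ᶠa≢0 q η≢0) (begin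
      η ^ᶠ q * t ^ᶠ q        ≡⟨ *-comm _ _ ⟩
      t ^ᶠ q * η ^ᶠ q        ≡⟨ sym (^ᶠ-distribʳ-* t η q) ⟩
      (t * η) ^ᶠ q           ≡⟨ cong (_^ᶠ q) tη≡e ⟩
      e ^ᶠ q                 ≡⟨ s≡0⇒^ᶠq≡- se≡0 ⟩
      - (δ * e)              ≡⟨ cong (λ z → - (δ * z)) (sym tη≡e) ⟩
      - (δ * (t * η))        ≡⟨ solve 3 (λ d t η → :- (d :* (t :* η)) := (:- (d :* η)) :* t) refl δ t η ⟩
      - (δ * η) * t          ≡⟨ cong (_* t) (sym (s≡0⇒^ᶠq≡- sη≡0)) ⟩
      η ^ᶠ q * t             ∎)

  InFq-*-cancelˡ : ∀ {c u} → c ≢ 0# → InFq c → InFq (c * u) → InFq u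
  InFq-*-cancelˡ {c} {u} c≢0 c∈Fq cu∈Fq = *-cancelˡ c≢0 (begin
    c * u ^ᶠ q         ≡⟨ cong (_* u ^ᶠ q) (sym c∈Fq) ⟩
    c ^ᶠ q * u ^ᶠ q    ≡⟨ sym (^ᶠ-distribʳ-* c u q) ⟩
    (c * u) ^ᶠ q       ≡⟨ cu∈Fq ⟩
    c * u              ∎)

  permutation⇒inverse : ∀ {f} → IsPermutation f → ∃ λ h → IsCompInverse f h
  permutation⇒inverse {f} (f-injective , f-surjective) = h , f∘h≗id , h∘f≗id
    where
    h : K → K
    h y = proj₁ (f-surjective y)
    f∘h≗id : ∀ y → f (h y) ≡ y
    f∘h≗id y = proj₂ (f-surjective y)
    h∘f≗id : ∀ x → h (f x) ≡ x
    h∘f≗id x = f-injective _ _ (f∘h≗id (f x))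

  module _ (δi : K) (δi^ᶠ[q+1]≡1 : δi ^ᶠ (q ℕ.+ 1) ≡ 1#) (η : K) (η≢0 : η ≢ 0#)
           (L : LinPoly) (L[ker-sᵢ]⊆Fqη : ∀ x → s δi x ≡ 0# → ∃ λ c → InFq c × evalLin L x ≡ c * η)
           (M : LinPoly) (M-inverse : IsCompInverse (evalLin L) (evalLin M))
           (δj : K) (sη≡0 : s δj η ≡ 0#) where

    Fqη⊆L[ker-sᵢ] : ∀ {k c t} → k ≢ 0# → s δi k ≡ 0# → InFq c → evalLin L k ≡ c * η → InFq t →
                    ∃ λ z → s δi z ≡ 0# × evalLin L z ≡ t * η
    Fqη⊆L[ker-sᵢ] {k} {c} {t} k≢0 sk≡0 c∈Fq Lk≡cη t∈Fq = u * k , su*k≡0 , L[u*k]≡tη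
      where
      c≢0 : c ≢ 0#
      c≢0 c≡0 = k≢0 (begin
        k                          ≡⟨ sym (proj₂ M-inverse k) ⟩
        evalLin M (evalLin L k)    ≡⟨ cong (evalLin M) (trans Lk≡cη (trans (cong (_* η) c≡0) (zeroˡ η))) ⟩
        evalLin M 0#               ≡⟨ evalLin-0 M ⟩
        0#                         ∎)
      c⁻¹ = proj₁ (inv c c≢0)
      u = t * c⁻¹
      cu≡t : c * u ≡ t
      cu≡t = trans (solve 3 (λ c t c⁻¹ → c :* (t :* c⁻¹) := t :* (c :* c⁻¹)) refl c t c⁻¹)
                   (trans (cong (t *_) (proj₂ (inv c c≢0))) (*-identityʳ t))
      u∈Fq : InFq u
      u∈Fq = InFq-*-cancelˡ c≢0 c∈Fq (subst InFq (sym cu≡t) t∈Fq)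
      su*k≡0 : s δi (u * k) ≡ 0#
      su*k≡0 = trans (s-*-InFq δi k u∈Fq) (trans (cong (u *_) sk≡0) (zeroʳ u))
      L[u*k]≡tη : evalLin L (u * k) ≡ t * η
      L[u*k]≡tη = begin
        evalLin L (u * k)    ≡⟨ evalLin-*-InFq L k u∈Fq ⟩
        u * evalLin L k      ≡⟨ cong (u *_) Lk≡cη ⟩
        u * (c * η)          ≡⟨ solve 3 (λ u c η → u :* (c :* η) := (c :* u) :* η) refl u c η ⟩
        (c * u) * η          ≡⟨ cong (_* η) cu≡t ⟩
        t * η                ∎

    ker-sⱼ⊆L[ker-sᵢ] : ∀ {e} → s δj e ≡ 0# → ∃ λ z → s δi z ≡ 0# × evalLin L z ≡ e
    ker-sⱼ⊆L[ker-sᵢ] {e} se≡0 =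
      let k , k≢0 , sk≡0 = ∃-nonzero-kernel δi δi^ᶠ[q+1]≡1
          c , c∈Fq , Lk≡cη = L[ker-sᵢ]⊆Fqη k sk≡0
          t , t∈Fq , e≡tη = kernel-multiple η≢0 sη≡0 se≡0
      in subst (λ y → ∃ λ z → s δi z ≡ 0# × evalLin L z ≡ y) (sym e≡tη) (Fqη⊆L[ker-sᵢ] k≢0 sk≡0 c∈Fq Lk≡cη t∈Fq)

    module _ (Φ : K → K) where
      private
        f : K → K
        f x = Φ (s δi x) + evalLin L x

      f-translate : ∀ x {z} → s δi z ≡ 0# → f (x + z) ≡ f x + evalLin L z
      f-translate x {z} sz≡0 = begin
        Φ (s δi (x + z)) + evalLin L (x + z)              ≡⟨ cong₂ (λ a b → Φ a + b) s[x+z]≡sx (evalLin-+ L x z) ⟩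
        Φ (s δi x) + (evalLin L x + evalLin L z)          ≡⟨ sym (+-assoc _ _ _) ⟩
        Φ (s δi x) + evalLin L x + evalLin L z            ∎
        where
        s[x+z]≡sx : s δi (x + z) ≡ s δi x
        s[x+z]≡sx = trans (s-+ δi x z) (trans (cong (s δi x +_) sz≡0) (+-identityʳ _))

      inverse-translate : ∀ {h} → IsCompInverse f h → ∀ x {e} → s δj e ≡ 0# → h (x + e) ≡ h x + evalLin M e
      inverse-translate {h} (f∘h≗id , h∘f≗id) x {e} se≡0 =
        let z , sz≡0 , Lz≡e = ker-sⱼ⊆L[ker-sᵢ] se≡0 in begin
        h (x + e)                   ≡⟨ cong (λ y → h (y + e)) (sym (f∘h≗id x)) ⟩
        h (f (h x) + e)             ≡⟨ cong (λ y → h (f (h x) + y)) (sym Lz≡e) ⟩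
        h (f (h x) + evalLin L z)   ≡⟨ cong h (sym (f-translate (h x) sz≡0)) ⟩
        h (f (h x + z))             ≡⟨ h∘f≗id (h x + z) ⟩
        h x + z                     ≡⟨ cong (h x +_) (sym (trans (cong (evalLin M) (sym Lz≡e)) (proj₂ M-inverse z))) ⟩
        h x + evalLin M e           ∎

      ∃-inverse-of-shape : IsPermutation f → Σ (List K) λ g₁ → IsCompInverse f (λ x → evalPoly g₁ (s δj x) + evalLin M x)
      ∃-inverse-of-shape f-permutation = interpolate v , f∘h′≗id , h′∘f≗id
        where
        h = proj₁ (permutation⇒inverse f-permutation)
        h-inverse = proj₂ (permutation⇒inverse f-permutation)
        φ : K → K
        φ x = h x - evalLin M x
        φ-respects-s : ∀ x x′ → s δj x ≡ s δj x′ → φ x ≡ φ x′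
        φ-respects-s x x′ sx≡sx′ = begin
          h x - evalLin M x                                      ≡⟨ solve 3 (λ a b c → a :- b := (a :+ c) :- (b :+ c)) refl (h x) (evalLin M x) (evalLin M e) ⟩
          (h x + evalLin M e) - (evalLin M x + evalLin M e)      ≡⟨ cong₂ _-_ (sym (inverse-translate h-inverse x se≡0)) (sym (evalLin-+ M x e)) ⟩
          h (x + e) - evalLin M (x + e)                          ≡⟨ cong (λ y → h y - evalLin M y) x+e≡x′ ⟩
          h x′ - evalLin M x′                                    ∎
          where
          e = x′ - x
          x+e≡x′ : x + e ≡ x′
          x+e≡x′ = solve 2 (λ x x′ → x :+ (x′ :- x) := x′) refl x x′
          se≡0 : s δj e ≡ 0#
          se≡0 = begin
            s δj (x′ - x)                ≡⟨ s-sub δj x′ x ⟩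
            s δj x′ - s δj x             ≡⟨ cong (λ y → s δj x′ - y) sx≡sx′ ⟩
            s δj x′ - s δj x′            ≡⟨ -‿inverseʳ _ ⟩
            0#                           ∎
        v = proj₁ (factorise (s δj) φ φ-respects-s)
        h′≗h : ∀ x → evalPoly (interpolate v) (s δj x) + evalLin M x ≡ h x
        h′≗h x = begin
          evalPoly (interpolate v) (s δj x) + evalLin M x  ≡⟨ cong (_+ evalLin M x) (evalPoly-interpolate v (s δj x)) ⟩
          v (s δj x) + evalLin M x                         ≡⟨ cong (_+ evalLin M x) (proj₂ (factorise (s δj) φ φ-respects-s) x) ⟩
          (h x - evalLin M x) + evalLin M x                ≡⟨ solve 2 (λ a b → (a :- b) :+ b := a) refl (h x) (evalLin M x) ⟩
          h x                                              ∎
        f∘h′≗id : ∀ x → f (evalPoly (interpolate v) (s δj x) + evalLin M x) ≡ x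
        f∘h′≗id x = trans (cong f (h′≗h x)) (proj₁ h-inverse x)
        h′∘f≗id : ∀ x → evalPoly (interpolate v) (s δj (f x)) + evalLin M (f x) ≡ x
        h′∘f≗id x = trans (h′≗h (f x)) (proj₂ h-inverse x)

corollary4 : (q : ℕ) → IsPrimePower q → (F : FiniteField (q ^ 2)) →
  let open OverFq² q F in
  (δi : K) → δi ^ᶠ (q Data.Nat.+ 1) ≡ 1# →
  (m : ℕ) → 2 ≤ m →
  (a : ℕ → K) → (∀ i → 2 ≤ i → i ≤ m → InFq (a i)) → a m ≡ 1# →
  (λ' : K) → ¬ (λ' ≡ 0#) → ∃ (λ x → (x ^ᶠ q) + δi * x ≡ λ') →
  (L : LinPoly) → Rank2 L →
  (∀ x → (x ^ᶠ q) + δi * x ≡ 0# →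
     ∃ λ c → InFq c × evalLin L x ≡ c * (λ' ^ᶠ m)) →
  IsPermutation (λ x → sumFrom 2 (m ∸ 1)
                         (λ i → (λ' ^ᶠ (m ∸ i)) * a i * (((x ^ᶠ q) + δi * x) ^ᶠ i))
                       + evalLin L x) →
  (M : LinPoly) → Rank2 M →
  IsCompInverse (evalLin L) (evalLin M) →
  (δj : K) → δj ^ᶠ (q Data.Nat.+ 1) ≡ 1# →
  ((λ' ^ᶠ m) ^ᶠ q) + δj * (λ' ^ᶠ m) ≡ 0# →
  Σ (List K) λ g₁ →
    IsCompInverse
      (λ x → sumFrom 2 (m ∸ 1)
               (λ i → (λ' ^ᶠ (m ∸ i)) * a i * (((x ^ᶠ q) + δi * x) ^ᶠ i))
             + evalLin L x)
      (λ x → evalPoly g₁ ((x ^ᶠ q) + δj * x) + evalLin M x)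
corollary4 q q-primePower F δi δi^ᶠ[q+1]≡1 m _ a _ _ λ′ λ′≢0 _ L _ L[ker-sᵢ]⊆Fqλ′^m f-permutation M _ M-inverse δj _ sλ′^m≡0 =
  ∃-inverse-of-shape δi δi^ᶠ[q+1]≡1 (λ′ ^ᶠ m) (x≢0⇒x^ᶠa≢0 m λ′≢0) L L[ker-sᵢ]⊆Fqλ′^m M M-inverse δj sλ′^m≡0
    (λ y → sumFrom 2 (m ∸ 1) (λ i → (λ′ ^ᶠ (m ∸ i)) * a i * (y ^ᶠ i))) f-permutation
  where
  open FiniteFieldProperties F
  open OverFq²Properties q q-primePower F
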